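{- Let $n\geq 1$ and $0\leq m\leq\binom n2$ be integers, and let $j,k$ be the unique integers with $1\leq j\leq k$ and $m=\binom{k+1}{2}-j$. Then $$H(C^1_{n,m})=\tfrac12k^4-\tfrac12k^3-3jk^2+(j^2+7j+1)k-\tfrac{5j^2+7j}{2}.$$
   Context: $C^1_{n,m}=(K_{k-j}\vee(K_1\cup K_j))\cup(n-k-1)K_1$, where $\vee$ denotes join, $\cup$ disjoint union, $sK_1$ is $s$ isolated vertices. For a graph $G$, $H(G)=M_2(G)-6k_3(G)$, where $M_2(G)=\sum_{uv\in E(G)}d_G(u)d_G(v)$ and $k_3(G)$ is the number of triangles of $G$. -}

module Defs where

open import Data.Nat using (ℕ; zero; suc; _+_; _*_; _<ᵇ_; _≡ᵇ_; _≤ᵇ_)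
open import Data.Bool using (Bool; true; false; if_then_else_; _∧_; _∨_; not)
open import Data.Fin using (Fin; toℕ)
open import Data.List using (List; map; allFin)
open import Data.Nat.ListAction using (sum)
open import Data.Integer using (ℤ; +_; _-_)

-- A (simple) graph on the vertex set Fin n, given by a Boolean adjacency
-- function (intended symmetric and irreflexive).
Graph : ℕ → Set
Graph n = Fin n → Fin n → Bool

Σv : ∀ {n} → (Fin n → ℕ) → ℕ
Σv {n} f = sum (map f (allFin n))

[_] : Bool → ℕ
[ b ] = if b then 1 else 0

deg : ∀ {n} → Graph n → Fin n → ℕ
deg G u = Σv (λ v → [ G u v ])

M₂ : ∀ {n} → Graph n → ℕ
M₂ G = Σv (λ u → Σv (λ v →
         if (toℕ u <ᵇ toℕ v) ∧ G u v then deg G u * deg G v else 0))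

k₃ : ∀ {n} → Graph n → ℕ
k₃ G = Σv (λ u → Σv (λ v → Σv (λ w →
         [ (toℕ u <ᵇ toℕ v) ∧ (toℕ v <ᵇ toℕ w) ∧ G u v ∧ G v w ∧ G u w ])))

H : ∀ {n} → Graph n → ℤ
H G = + M₂ G - + (6 * k₃ G)

-- C¹_{n,m} = (K_{k−j} ∨ (K₁ ∪ K_j)) ∪ (n−k−1) K₁, on vertex set Fin n:
--   vertices 0 .. j−1      : the clique K_j
--   vertices j .. k−1      : the clique K_{k−j}
--   vertex   k             : the K₁ (joined to K_{k−j} only)
--   vertices k+1 .. n−1    : isolated vertices
-- (The join makes {0..k−1} a clique; the K₁ is adjacent exactly to j..k−1.)
C¹edge : ℕ → ℕ → ℕ → ℕ → Bool
C¹edge j k a b =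
     (not (a ≡ᵇ b) ∧ (a <ᵇ k) ∧ (b <ᵇ k))
  ∨ ((a ≡ᵇ k) ∧ (j ≤ᵇ b) ∧ (b <ᵇ k))
  ∨ ((b ≡ᵇ k) ∧ (j ≤ᵇ a) ∧ (a <ᵇ k))

C¹ : (n j k : ℕ) → Graph n
C¹ n j k u v = C¹edge j k (toℕ u) (toℕ v)

{-# OPTIONS --safe #-}
module Submission where

-- Write k = j + t.  On the vertices 0, …, k the graph C¹ is the union of the clique on
-- A ∪ B, where A = [0, j) and B = [j, k), and the clique on B ∪ {k}; every other vertex is
-- isolated, and the hypothesis on m forces n > k unless t = 0, in which case k is isolated
-- as well.  Hence vertices of A have degree k − 1, those of B degree k and k itself degree t,
-- and splitting the sums over edges and triangles along A and B ∪ {k} gives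
--   M₂ = C(j,2)(k−1)² + jt(k−1)k + C(t,2)k² + t²k,
--   k₃ = C(j,3) + C(j,2)t + jC(t,2) + C(t+1,3).
-- The formula is then a polynomial identity in j and t, since 2H only involves the
-- polynomials 2C(j,2), 2C(t,2), 6C(j,3) and 6C(t+1,3).

open import Defs
open import Data.Nat using (ℕ; _≤_)
open import Data.Nat.Combinatorics using (_C_)

-- A module of its own, so that Data.Integer's _+_ and _*_ can be opened unqualified below.
module Counting where

  open import Data.Nat
    using (zero; suc; pred; _+_; _*_; _<_; z≤n; s≤s; z<s; s<s; s≤s⁻¹; _<ᵇ_; _≡ᵇ_; _≤ᵇ_)
  open import Data.Nat.Properties
  open import Data.Nat.Combinatorics using (nCk+nC[k+1]≡[n+1]C[k+1]; nC1≡n)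
  open import Data.Bool using (Bool; true; false; if_then_else_; _∧_; _∨_; not)
  open import Data.Bool.Properties
    using (if-cong; if-cong-then; if-∧; ∧-zeroʳ; ∧-identityʳ; ∧-comm; ∧-idem; ∨-identityʳ; ∨-comm)
  open import Data.Fin using (toℕ)
  open import Data.List using (tabulate)
  open import Data.List.Properties using (map-tabulate)
  open import Data.Nat.ListAction using (sum)
  open import Data.Product using (_,_; _×_; ∃-syntax)
  open import Data.Sum using (_⊎_; inj₁; inj₂; map₂)
  open import Function using (_∘_; id)
  open import Relation.Nullary using (contradiction)
  open import Relation.Nullary.Reflects using (Reflects; ofʸ; ofⁿ; det; fromEquivalence)
  open import Relation.Binary.PropositionalEquality
    using (_≡_; _≢_; refl; sym; trans; cong; cong₂; subst; subst₂; module ≡-Reasoning)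
  open import Algebra.Properties.CommutativeSemigroup +-commutativeSemigroup using (interchange)

  <ᵇ-true : ∀ {m n} → m < n → (m <ᵇ n) ≡ true
  <ᵇ-true m<n = det (<ᵇ-reflects-< _ _) (ofʸ m<n)

  <ᵇ-false : ∀ {m n} → n ≤ m → (m <ᵇ n) ≡ false
  <ᵇ-false n≤m = det (<ᵇ-reflects-< _ _) (ofⁿ (≤⇒≯ n≤m))

  <ᵇ-irrefl : ∀ n → (n <ᵇ n) ≡ false
  <ᵇ-irrefl n = <ᵇ-false (≤-refl {n})

  +-<ᵇ-+ : ∀ m a b → (m + a <ᵇ m + b) ≡ (a <ᵇ b)
  +-<ᵇ-+ zero    a b = refl
  +-<ᵇ-+ (suc m) a b = +-<ᵇ-+ m a b

  ≤ᵇ-true : ∀ {m n} → m ≤ n → (m ≤ᵇ n) ≡ true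
  ≤ᵇ-true m≤n = det (≤ᵇ-reflects-≤ _ _) (ofʸ m≤n)

  ≤ᵇ-false : ∀ {m n} → n < m → (m ≤ᵇ n) ≡ false
  ≤ᵇ-false n<m = det (≤ᵇ-reflects-≤ _ _) (ofⁿ (<⇒≱ n<m))

  ≡ᵇ-reflects-≡ : ∀ m n → Reflects (m ≡ n) (m ≡ᵇ n)
  ≡ᵇ-reflects-≡ m n = fromEquivalence (≡ᵇ⇒≡ m n) (≡⇒≡ᵇ m n)

  ≡ᵇ-refl : ∀ m → (m ≡ᵇ m) ≡ true
  ≡ᵇ-refl m = det (≡ᵇ-reflects-≡ m m) (ofʸ refl)

  ≡ᵇ-false : ∀ {m n} → m ≢ n → (m ≡ᵇ n) ≡ false
  ≡ᵇ-false m≢n = det (≡ᵇ-reflects-≡ _ _) (ofⁿ m≢n)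

  not-≡ᵇ : ∀ {m n} → m ≢ n → not (m ≡ᵇ n) ≡ true
  not-≡ᵇ m≢n = cong not (≡ᵇ-false m≢n)

  ≡ᵇ-comm : ∀ m n → (m ≡ᵇ n) ≡ (n ≡ᵇ m)
  ≡ᵇ-comm zero    zero    = refl
  ≡ᵇ-comm zero    (suc n) = refl
  ≡ᵇ-comm (suc m) zero    = refl
  ≡ᵇ-comm (suc m) (suc n) = ≡ᵇ-comm m n

  +-≡ᵇ-+ : ∀ m a b → (m + a ≡ᵇ m + b) ≡ (a ≡ᵇ b)
  +-≡ᵇ-+ zero    a b = refl
  +-≡ᵇ-+ (suc m) a b = +-≡ᵇ-+ m a b

  -- Sums over initial segments of ℕ

  ∑< : ℕ → (ℕ → ℕ) → ℕ
  ∑< zero    f = 0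
  ∑< (suc n) f = f 0 + ∑< n (f ∘ suc)

  infix 5 ∑<
  syntax ∑< n (λ i → e) = ∑[ i < n ] e

  ∑-cong : ∀ n {f g : ℕ → ℕ} → (∀ {i} → i < n → f i ≡ g i) → ∑< n f ≡ ∑< n g
  ∑-cong zero    _   = refl
  ∑-cong (suc n) f≗g = cong₂ _+_ (f≗g z<s) (∑-cong n (λ i<n → f≗g (s<s i<n)))

  ∑-const : ∀ n c → ∑[ i < n ] c ≡ n * c
  ∑-const zero    c = refl
  ∑-const (suc n) c = cong (c +_) (∑-const n c)

  ∑-zero : ∀ n {f : ℕ → ℕ} → (∀ {i} → i < n → f i ≡ 0) → ∑< n f ≡ 0
  ∑-zero n f≗0 = trans (∑-cong n f≗0) (trans (∑-const n 0) (*-zeroʳ n))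

  ∑-+ : ∀ n (f g : ℕ → ℕ) → ∑[ i < n ] (f i + g i) ≡ ∑< n f + ∑< n g
  ∑-+ zero    f g = refl
  ∑-+ (suc n) f g =
    trans (cong (f 0 + g 0 +_) (∑-+ n (f ∘ suc) (g ∘ suc)))
          (interchange (f 0) (g 0) (∑< n (f ∘ suc)) (∑< n (g ∘ suc)))

  ∑-++ : ∀ m n (f : ℕ → ℕ) → ∑< (m + n) f ≡ ∑< m f + (∑[ i < n ] f (m + i))
  ∑-++ zero    n f = refl
  ∑-++ (suc m) n f = trans (cong (f 0 +_) (∑-++ m n (f ∘ suc))) (sym (+-assoc (f 0) _ _))

  ∑-snoc : ∀ n (f : ℕ → ℕ) → ∑< (suc n) f ≡ ∑< n f + f n
  ∑-snoc zero    f = +-comm (f 0) 0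
  ∑-snoc (suc n) f = trans (cong (f 0 +_) (∑-snoc n (f ∘ suc))) (sym (+-assoc (f 0) _ _))

  ∑-trim : ∀ {p n} {f : ℕ → ℕ} → (∀ {i} → p ≤ i → f i ≡ 0) → p ≤ n → ∑< n f ≡ ∑< p f
  ∑-trim {p} {f = f} f≗0 p≤n with m≤n⇒∃[o]m+o≡n p≤n
  ... | r , refl =
    trans (∑-++ p r f) (trans (cong (∑< p f +_) (∑-zero r (λ _ → f≗0 (m≤m+n p _)))) (+-identityʳ _))

  Σv≡∑ : ∀ n (f : ℕ → ℕ) → Σv {n} (f ∘ toℕ) ≡ ∑< n f
  Σv≡∑ n f = trans (cong sum (map-tabulate {n = n} id (f ∘ toℕ))) (sum-tabulate n f)
    where
    sum-tabulate : ∀ n (f : ℕ → ℕ) → sum (tabulate {n = n} (f ∘ toℕ)) ≡ ∑< n f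
    sum-tabulate zero    f = refl
    sum-tabulate (suc n) f = cong (f 0 +_) (sum-tabulate n (f ∘ suc))

  -- Sums over increasing pairs and triples

  ∑above : ℕ → ℕ → (ℕ → ℕ) → ℕ
  ∑above n v h = ∑[ w < n ] (if v <ᵇ w then h w else 0)

  ∑pairs : ℕ → (ℕ → ℕ → ℕ) → ℕ
  ∑pairs n f = ∑[ u < n ] ∑above n u (f u)

  ∑triples : ℕ → (ℕ → ℕ → ℕ → ℕ) → ℕ
  ∑triples n g = ∑pairs n (λ u v → ∑above n v (g u v))

  ∑above-cong : ∀ {n v} {h h′ : ℕ → ℕ} → (∀ {w} → v < w → w < n → h w ≡ h′ w) →
                ∑above n v h ≡ ∑above n v h′
  ∑above-cong {n} {v} h≗h′ = ∑-cong n (λ {w} w<n → guarded w (λ v<w → h≗h′ v<w w<n))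
    where
    guarded : ∀ w {x y : ℕ} → (v < w → x ≡ y) →
              (if v <ᵇ w then x else 0) ≡ (if v <ᵇ w then y else 0)
    guarded w x≡y with v <ᵇ w | <ᵇ-reflects-< v w
    ... | true  | ofʸ v<w = x≡y v<w
    ... | false | _       = refl

  ∑pairs-cong : ∀ {n} {f f′ : ℕ → ℕ → ℕ} → (∀ {u v} → u < v → v < n → f u v ≡ f′ u v) →
                ∑pairs n f ≡ ∑pairs n f′
  ∑pairs-cong {n} f≗f′ = ∑-cong n (λ _ → ∑above-cong f≗f′)

  ∑triples-cong : ∀ {n} {g g′ : ℕ → ℕ → ℕ → ℕ} →
                  (∀ {u v w} → u < v → v < w → w < n → g u v w ≡ g′ u v w) →
                  ∑triples n g ≡ ∑triples n g′
  ∑triples-cong {n} g≗g′ =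
    ∑pairs-cong {n} (λ u<v v<n → ∑above-cong (λ v<w w<n → g≗g′ u<v v<w w<n))

  ∑above-+ : ∀ n v (h h′ : ℕ → ℕ) →
             ∑above n v (λ w → h w + h′ w) ≡ ∑above n v h + ∑above n v h′
  ∑above-+ n v h h′ = trans (∑-cong n (λ {w} _ → if-+ (v <ᵇ w))) (∑-+ n _ _)
    where
    if-+ : ∀ b {x y : ℕ} → (if b then x + y else 0) ≡ (if b then x else 0) + (if b then y else 0)
    if-+ true  = refl
    if-+ false = refl

  ∑pairs-+ : ∀ n (f f′ : ℕ → ℕ → ℕ) →
             ∑pairs n (λ u v → f u v + f′ u v) ≡ ∑pairs n f + ∑pairs n f′
  ∑pairs-+ n f f′ = trans (∑-cong n (λ {u} _ → ∑above-+ n u (f u) (f′ u))) (∑-+ n _ _)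

  ∑above-++ˡ : ∀ {m n v} (h : ℕ → ℕ) → v < m →
               ∑above (m + n) v h ≡ ∑above m v h + (∑[ w < n ] h (m + w))
  ∑above-++ˡ {m} {n} {v} h v<m =
    trans (∑-++ m n _) (cong (∑above m v h +_) (∑-cong n (λ {w} _ →
      if-cong (<ᵇ-true (<-≤-trans v<m (m≤m+n m w))))))

  ∑above-++ʳ : ∀ {m n} v (h : ℕ → ℕ) → ∑above (m + n) (m + v) h ≡ ∑above n v (λ w → h (m + w))
  ∑above-++ʳ {m} {n} v h =
    trans (∑-++ m n _) (cong₂ _+_
      (∑-zero m (λ w<m → if-cong (<ᵇ-false (≤-trans (<⇒≤ w<m) (m≤m+n m v)))))
      (∑-cong n (λ {w} _ → if-cong (+-<ᵇ-+ m v w))))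

  ∑pairs-++ : ∀ m n (f : ℕ → ℕ → ℕ) →
              ∑pairs (m + n) f
              ≡ ∑pairs m f + (∑[ u < m ] ∑[ v < n ] f u (m + v))
                + ∑pairs n (λ u v → f (m + u) (m + v))
  ∑pairs-++ m n f = begin
    ∑pairs (m + n) f
      ≡⟨ ∑-++ m n _ ⟩
    (∑[ u < m ] ∑above (m + n) u (f u)) + (∑[ u < n ] ∑above (m + n) (m + u) (f (m + u)))
      ≡⟨ cong₂ _+_ (∑-cong m (λ {u} → ∑above-++ˡ {m} {n} (f u)))
                   (∑-cong n (λ {u} _ → ∑above-++ʳ {m} {n} u (f (m + u)))) ⟩
    (∑[ u < m ] (∑above m u (f u) + (∑[ v < n ] f u (m + v))))
    + ∑pairs n (λ u v → f (m + u) (m + v))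
      ≡⟨ cong (_+ ∑pairs n (λ u v → f (m + u) (m + v))) (∑-+ m _ _) ⟩
    ∑pairs m f + (∑[ u < m ] ∑[ v < n ] f u (m + v)) + ∑pairs n (λ u v → f (m + u) (m + v)) ∎
    where open ≡-Reasoning

  ∑triples-++ : ∀ m n (g : ℕ → ℕ → ℕ → ℕ) →
                ∑triples (m + n) g
                ≡ ∑triples m g + ∑pairs m (λ u v → ∑[ w < n ] g u v (m + w))
                  + (∑[ u < m ] ∑pairs n (λ v w → g u (m + v) (m + w)))
                  + ∑triples n (λ u v w → g (m + u) (m + v) (m + w))
  ∑triples-++ m n g = begin
    ∑triples (m + n) g
      ≡⟨ ∑pairs-++ m n _ ⟩
    ∑pairs m (λ u v → ∑above (m + n) v (g u v))
    + (∑[ u < m ] ∑[ v < n ] ∑above (m + n) (m + v) (g u (m + v)))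
    + ∑pairs n (λ u v → ∑above (m + n) (m + v) (g (m + u) (m + v)))
      ≡⟨ cong₂ _+_ (cong₂ _+_
           (∑pairs-cong {m} (λ {u} {v} _ v<m → ∑above-++ˡ {m} {n} (g u v) v<m))
           (∑-cong m (λ {u} _ → ∑-cong n (λ {v} _ → ∑above-++ʳ {m} {n} v (g u (m + v))))))
           (∑pairs-cong {n} (λ {u} {v} _ _ → ∑above-++ʳ {m} {n} v (g (m + u) (m + v)))) ⟩
    ∑pairs m (λ u v → ∑above m v (g u v) + (∑[ w < n ] g u v (m + w)))
    + (∑[ u < m ] ∑pairs n (λ v w → g u (m + v) (m + w)))
    + ∑triples n (λ u v w → g (m + u) (m + v) (m + w))
      ≡⟨ cong (λ x → x + (∑[ u < m ] ∑pairs n (λ v w → g u (m + v) (m + w)))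
                         + ∑triples n (λ u v w → g (m + u) (m + v) (m + w)))
              (∑pairs-+ m _ _) ⟩
    ∑triples m g + ∑pairs m (λ u v → ∑[ w < n ] g u v (m + w))
    + (∑[ u < m ] ∑pairs n (λ v w → g u (m + v) (m + w)))
    + ∑triples n (λ u v w → g (m + u) (m + v) (m + w)) ∎
    where open ≡-Reasoning

  ∑pairs-snoc : ∀ n (f : ℕ → ℕ → ℕ) → ∑pairs (suc n) f ≡ ∑pairs n f + (∑[ u < n ] f u n)
  ∑pairs-snoc n f = begin
    ∑pairs (suc n) f
      ≡⟨ cong (λ N → ∑pairs N f) (+-comm 1 n) ⟩
    ∑pairs (n + 1) f
      ≡⟨ ∑pairs-++ n 1 f ⟩
    ∑pairs n f + (∑[ u < n ] (f u (n + 0) + 0)) + 0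
      ≡⟨ +-identityʳ _ ⟩
    ∑pairs n f + (∑[ u < n ] (f u (n + 0) + 0))
      ≡⟨ cong (∑pairs n f +_) (∑-cong n (λ {u} _ →
           trans (+-identityʳ _) (cong (f u) (+-identityʳ n)))) ⟩
    ∑pairs n f + (∑[ u < n ] f u n) ∎
    where open ≡-Reasoning

  [1+n]C2≡n+nC2 : ∀ n → suc n C 2 ≡ n + n C 2
  [1+n]C2≡n+nC2 n = trans (sym (nCk+nC[k+1]≡[n+1]C[k+1] n 1)) (cong (_+ n C 2) (nC1≡n n))

  C2-mono-≤ : ∀ {m n} → m ≤ n → m C 2 ≤ n C 2
  C2-mono-≤ z≤n = z≤n
  C2-mono-≤ {suc m} {suc n} (s≤s m≤n) =
    subst₂ _≤_ (sym ([1+n]C2≡n+nC2 m)) (sym ([1+n]C2≡n+nC2 n)) (+-mono-≤ m≤n (C2-mono-≤ m≤n))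

  ∑pairs-const : ∀ n c → ∑pairs n (λ _ _ → c) ≡ (n C 2) * c
  ∑pairs-const zero    c = refl
  ∑pairs-const (suc n) c = begin
    ∑pairs (suc n) (λ _ _ → c)             ≡⟨ ∑pairs-snoc n _ ⟩
    ∑pairs n (λ _ _ → c) + (∑[ u < n ] c)  ≡⟨ cong₂ _+_ (∑pairs-const n c) (∑-const n c) ⟩
    (n C 2) * c + n * c                    ≡⟨ *-distribʳ-+ c (n C 2) n ⟨
    (n C 2 + n) * c                        ≡⟨ cong (_* c) (+-comm (n C 2) n) ⟩
    (n + n C 2) * c                        ≡⟨ cong (_* c) ([1+n]C2≡n+nC2 n) ⟨
    (suc n C 2) * c                        ∎
    where open ≡-Reasoning

  ∑triples-one : ∀ n → ∑triples n (λ _ _ _ → 1) ≡ n C 3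
  ∑triples-one zero    = refl
  ∑triples-one (suc n) = begin
    ∑triples (1 + n) (λ _ _ _ → 1)
      ≡⟨ ∑triples-++ 1 n (λ _ _ _ → 1) ⟩
    ∑pairs n (λ _ _ → 1) + 0 + ∑triples n (λ _ _ _ → 1)
      ≡⟨ cong₂ _+_ (trans (+-identityʳ _) (trans (∑pairs-const n 1) (*-identityʳ _)))
                   (∑triples-one n) ⟩
    n C 2 + n C 3
      ≡⟨ nCk+nC[k+1]≡[n+1]C[k+1] n 2 ⟩
    suc n C 3 ∎
    where open ≡-Reasoning

  -- M₂ and k₃ of edge predicates on ℕ

  restrict : ∀ n → (ℕ → ℕ → Bool) → Graph n
  restrict n e u v = e (toℕ u) (toℕ v)

  degℕ : ℕ → (ℕ → ℕ → Bool) → ℕ → ℕ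
  degℕ n e a = ∑[ b < n ] [ e a b ]

  M₂ℕ : ℕ → (ℕ → ℕ → Bool) → ℕ
  M₂ℕ n e = ∑pairs n (λ a b → if e a b then degℕ n e a * degℕ n e b else 0)

  k₃ℕ : ℕ → (ℕ → ℕ → Bool) → ℕ
  k₃ℕ n e = ∑triples n (λ u v w → [ e u v ∧ e v w ∧ e u w ])

  M₂-restrict : ∀ n e → M₂ (restrict n e) ≡ M₂ℕ n e
  M₂-restrict n e = begin
    M₂ (restrict n e)
      ≡⟨ Σv≡∑ n (λ a → Σv {n} (λ v → summand a (toℕ v))) ⟩
    ∑[ a < n ] Σv {n} (λ v → summand a (toℕ v))
      ≡⟨ ∑-cong n (λ {a} _ → Σv≡∑ n (summand a)) ⟩
    ∑[ a < n ] ∑[ b < n ] summand a b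
      ≡⟨ ∑-cong n (λ {a} _ → ∑-cong n (λ {b} _ → trans (if-∧ (a <ᵇ b))
           (if-cong-then (a <ᵇ b) (if-cong-then (e a b) (cong₂ _*_ (deg≡ a) (deg≡ b)))))) ⟩
    M₂ℕ n e ∎
    where
    open ≡-Reasoning
    D : ℕ → ℕ
    D a = Σv {n} (λ w → [ e a (toℕ w) ])
    summand : ℕ → ℕ → ℕ
    summand a b = if (a <ᵇ b) ∧ e a b then D a * D b else 0
    deg≡ : ∀ a → D a ≡ degℕ n e a
    deg≡ a = Σv≡∑ n (λ b → [ e a b ])

  k₃-restrict : ∀ n e → k₃ (restrict n e) ≡ k₃ℕ n e
  k₃-restrict n e = begin
    k₃ (restrict n e)
      ≡⟨ Σv≡∑ n (λ u → Σv {n} (λ v → Σv {n} (λ w → summand u (toℕ v) (toℕ w)))) ⟩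
    ∑[ u < n ] Σv {n} (λ v → Σv {n} (λ w → summand u (toℕ v) (toℕ w)))
      ≡⟨ ∑-cong n (λ {u} _ → trans (Σv≡∑ n (λ v → Σv {n} (λ w → summand u v (toℕ w))))
                                   (∑-cong n (λ {v} _ → Σv≡∑ n (summand u v)))) ⟩
    ∑[ u < n ] ∑[ v < n ] ∑[ w < n ] summand u v w
      ≡⟨ ∑-cong n (λ {u} _ → ∑-cong n (λ {v} _ →
           trans (∑-cong n (λ {w} _ → [∧] (u <ᵇ v) _)) (∑-if n (u <ᵇ v) _))) ⟩
    ∑[ u < n ] ∑[ v < n ] (if u <ᵇ v then ∑[ w < n ] [ (v <ᵇ w) ∧ triangle u v w ] else 0)
      ≡⟨ ∑-cong n (λ {u} _ → ∑-cong n (λ {v} _ → if-cong-then (u <ᵇ v)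
           (∑-cong n (λ {w} _ → [∧] (v <ᵇ w) _)))) ⟩
    k₃ℕ n e ∎
    where
    open ≡-Reasoning
    triangle : ℕ → ℕ → ℕ → Bool
    triangle u v w = e u v ∧ e v w ∧ e u w
    summand : ℕ → ℕ → ℕ → ℕ
    summand u v w = [ (u <ᵇ v) ∧ (v <ᵇ w) ∧ triangle u v w ]
    [∧] : ∀ b x → [ b ∧ x ] ≡ (if b then [ x ] else 0)
    [∧] true  x = refl
    [∧] false x = refl
    ∑-if : ∀ n b (h : ℕ → ℕ) → ∑[ i < n ] (if b then h i else 0) ≡ (if b then ∑< n h else 0)
    ∑-if n true  h = refl
    ∑-if n false h = trans (∑-const n 0) (*-zeroʳ n)

  EdgesWithin : ℕ → (ℕ → ℕ → Bool) → Set
  EdgesWithin p e = ∀ {a b} → p ≤ a ⊎ p ≤ b → e a b ≡ false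

  if-zero : ∀ b {x : ℕ} → x ≡ 0 → (if b then x else 0) ≡ 0
  if-zero true  x≡0 = x≡0
  if-zero false _   = refl

  ∑above-trim : ∀ {p n v} {h : ℕ → ℕ} → (∀ {w} → p ≤ w → h w ≡ 0) → p ≤ n →
                ∑above n v h ≡ ∑above p v h
  ∑above-trim {v = v} h≗0 = ∑-trim (λ {w} p≤w → if-zero (v <ᵇ w) (h≗0 p≤w))

  ∑pairs-trim : ∀ {p n} {f : ℕ → ℕ → ℕ} → (∀ {a b} → p ≤ a ⊎ p ≤ b → f a b ≡ 0) → p ≤ n →
                ∑pairs n f ≡ ∑pairs p f
  ∑pairs-trim {p} {n} f≗0 p≤n =
    trans (∑-cong n (λ _ → ∑above-trim (λ p≤b → f≗0 (inj₂ p≤b)) p≤n))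
          (∑-trim (λ {a} p≤a → ∑-zero p (λ {b} _ → if-zero (a <ᵇ b) (f≗0 (inj₁ p≤a)))) p≤n)

  ∑triples-trim : ∀ {p n} {g : ℕ → ℕ → ℕ → ℕ} →
                  (∀ {u v w} → p ≤ u ⊎ p ≤ v ⊎ p ≤ w → g u v w ≡ 0) → p ≤ n →
                  ∑triples n g ≡ ∑triples p g
  ∑triples-trim {p} {n} {g} g≗0 p≤n =
    trans (∑pairs-cong {n} (λ {u} {v} _ _ →
             ∑above-trim {h = g u v} (λ p≤w → g≗0 (inj₂ (inj₂ p≤w))) p≤n))
          (∑pairs-trim (λ {u} {v} p≤u⊎p≤v → ∑-zero p (λ {w} _ →
             if-zero (v <ᵇ w) (g≗0 (outer p≤u⊎p≤v)))) p≤n)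
    where
    outer : ∀ {u v w} → p ≤ u ⊎ p ≤ v → p ≤ u ⊎ p ≤ v ⊎ p ≤ w
    outer (inj₁ p≤u) = inj₁ p≤u
    outer (inj₂ p≤v) = inj₂ (inj₁ p≤v)

  module _ {p : ℕ} {e : ℕ → ℕ → Bool} (within : EdgesWithin p e) {n : ℕ} (p≤n : p ≤ n) where

    degℕ-trim : ∀ a → degℕ n e a ≡ degℕ p e a
    degℕ-trim a = ∑-trim (λ p≤b → cong [_] (within (inj₂ p≤b))) p≤n

    M₂ℕ-trim : M₂ℕ n e ≡ M₂ℕ p e
    M₂ℕ-trim =
      trans (∑pairs-cong {n} (λ {a} {b} _ _ →
               if-cong-then (e a b) (cong₂ _*_ (degℕ-trim a) (degℕ-trim b))))
            (∑pairs-trim (λ p≤a⊎p≤b → if-cong (within p≤a⊎p≤b)) p≤n)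

    k₃ℕ-trim : k₃ℕ n e ≡ k₃ℕ p e
    k₃ℕ-trim = ∑triples-trim absent p≤n
      where
      absent : ∀ {u v w} → p ≤ u ⊎ p ≤ v ⊎ p ≤ w → [ e u v ∧ e v w ∧ e u w ] ≡ 0
      absent {u} {v} {w} (inj₁ p≤u) = cong (λ x → [ x ∧ e v w ∧ e u w ]) (within (inj₁ p≤u))
      absent {u} {v} {w} (inj₂ (inj₁ p≤v)) =
        cong (λ x → [ x ∧ e v w ∧ e u w ]) (within (inj₂ p≤v))
      absent {u} {v} {w} (inj₂ (inj₂ p≤w)) =
        cong [_] (trans (cong (λ x → e u v ∧ x ∧ e u w) (within (inj₂ p≤w))) (∧-zeroʳ (e u v)))

  -- The edges of C¹

  C¹edge-sym : ∀ j k a b → C¹edge j k a b ≡ C¹edge j k b a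
  C¹edge-sym j k a b =
    cong₂ _∨_ (cong₂ _∧_ (cong not (≡ᵇ-comm a b)) (∧-comm (a <ᵇ k) (b <ᵇ k)))
              (∨-comm ((a ≡ᵇ k) ∧ (j ≤ᵇ b) ∧ (b <ᵇ k)) ((b ≡ᵇ k) ∧ (j ≤ᵇ a) ∧ (a <ᵇ k)))

  C¹edge-below : ∀ j {k a b} → a < k → b < k → C¹edge j k a b ≡ not (a ≡ᵇ b)
  C¹edge-below j a<k b<k
    rewrite <ᵇ-true a<k | <ᵇ-true b<k | ≡ᵇ-false (<⇒≢ a<k) | ≡ᵇ-false (<⇒≢ b<k)
    = trans (∨-identityʳ _) (∧-identityʳ _)

  C¹edge-apex : ∀ j k b → C¹edge j k k b ≡ (j ≤ᵇ b) ∧ (b <ᵇ k)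
  C¹edge-apex j k b
    rewrite <ᵇ-irrefl k | ≡ᵇ-refl k
          | ∧-zeroʳ (not (k ≡ᵇ b)) | ∧-zeroʳ (j ≤ᵇ k) | ∧-zeroʳ (b ≡ᵇ k)
    = ∨-identityʳ _

  C¹edge-beyond : ∀ {j k a} b → k < a → C¹edge j k a b ≡ false
  C¹edge-beyond {j} {k} {a} b k<a
    rewrite <ᵇ-false (<⇒≤ k<a) | ≡ᵇ-false (>⇒≢ k<a)
          | ∧-zeroʳ (not (a ≡ᵇ b)) | ∧-zeroʳ (j ≤ᵇ a) | ∧-zeroʳ (b ≡ᵇ k)
    = refl

  edgesWithin-sym : ∀ {p} {e : ℕ → ℕ → Bool} → (∀ a b → e a b ≡ e b a) →
                    (∀ {a} b → p ≤ a → e a b ≡ false) → EdgesWithin p e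
  edgesWithin-sym sym-e isolated (inj₁ p≤a)         = isolated _ p≤a
  edgesWithin-sym sym-e isolated {a} {b} (inj₂ p≤b) = trans (sym-e a b) (isolated a p≤b)

  C¹edge-within : ∀ j k → EdgesWithin (suc k) (C¹edge j k)
  C¹edge-within j k = edgesWithin-sym (C¹edge-sym j k) (C¹edge-beyond {j})

  C¹edge-within-j : ∀ j → EdgesWithin j (C¹edge j j)
  C¹edge-within-j j = edgesWithin-sym (C¹edge-sym j j) isolated
    where
    isolated : ∀ {a} b → j ≤ a → C¹edge j j a b ≡ false
    isolated b j≤a with m≤n⇒m<n∨m≡n j≤a
    ... | inj₁ j<a  = C¹edge-beyond {j} b j<a
    ... | inj₂ refl with <-≤-connex b j
    ...   | inj₁ b<j = trans (C¹edge-apex j j b) (cong (_∧ (b <ᵇ j)) (≤ᵇ-false b<j))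
    ...   | inj₂ j≤b =
      trans (C¹edge-apex j j b) (trans (cong ((j ≤ᵇ b) ∧_) (<ᵇ-false j≤b)) (∧-zeroʳ _))

  count-≢ : ∀ {a n} → a < n → ∑[ b < n ] [ not (a ≡ᵇ b) ] ≡ pred n
  count-≢ {zero}  {suc n}       _           = trans (∑-const n 1) (*-identityʳ n)
  count-≢ {suc a} {suc (suc n)} (s<s a<1+n) = cong suc (count-≢ a<1+n)

  count-< : ∀ t → ∑[ i < suc t ] [ i <ᵇ t ] ≡ t
  count-< t = begin
    ∑[ i < suc t ] [ i <ᵇ t ]
      ≡⟨ ∑-snoc t _ ⟩
    (∑[ i < t ] [ i <ᵇ t ]) + [ t <ᵇ t ]
      ≡⟨ cong₂ _+_ (∑-cong t (λ i<t → cong [_] (<ᵇ-true i<t))) (cong [_] (<ᵇ-irrefl t)) ⟩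
    (∑[ i < t ] 1) + 0
      ≡⟨ trans (+-identityʳ _) (trans (∑-const t 1) (*-identityʳ t)) ⟩
    t ∎
    where open ≡-Reasoning

  -- The vertices 0, …, k of C¹edge j k, with k = j + t, split into A = [0, j) and
  -- B⁺ = [j, k] = B ∪ {k}, where k is the K₁.  Both are cliques, and a ∈ A is adjacent
  -- to j + i ∈ B⁺ exactly when i < t.

  module _ (j t : ℕ) where

    private
      k N d : ℕ
      k = j + t
      N = j + suc t
      d = pred j + t
      e : ℕ → ℕ → Bool
      e = C¹edge j k
      D : ℕ → ℕ
      D = degℕ N e

    edge-apex-B : ∀ {i} → i < t → e k (j + i) ≡ true
    edge-apex-B {i} i<t =
      trans (C¹edge-apex j k (j + i)) (cong₂ _∧_ (≤ᵇ-true (m≤m+n j i)) (<ᵇ-true (+-monoʳ-< j i<t)))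

    edge-A-A : ∀ {a b} → a < j → b < j → e a b ≡ not (a ≡ᵇ b)
    edge-A-A a<j b<j = C¹edge-below j (<-≤-trans a<j (m≤m+n j t)) (<-≤-trans b<j (m≤m+n j t))

    edge-A-B⁺ : ∀ {a i} → a < j → i ≤ t → e a (j + i) ≡ (i <ᵇ t)
    edge-A-B⁺ {a} {i} a<j i≤t with m≤n⇒m<n∨m≡n i≤t
    ... | inj₁ i<t = begin
      e a (j + i)       ≡⟨ C¹edge-below j (<-≤-trans a<j (m≤m+n j t)) (+-monoʳ-< j i<t) ⟩
      not (a ≡ᵇ j + i)  ≡⟨ not-≡ᵇ (<⇒≢ (<-≤-trans a<j (m≤m+n j i))) ⟩
      true              ≡⟨ <ᵇ-true i<t ⟨
      (i <ᵇ t)          ∎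
      where open ≡-Reasoning
    ... | inj₂ refl = begin
      e a k                ≡⟨ C¹edge-sym j k a k ⟩
      e k a                ≡⟨ C¹edge-apex j k a ⟩
      (j ≤ᵇ a) ∧ (a <ᵇ k)  ≡⟨ cong (_∧ (a <ᵇ k)) (≤ᵇ-false a<j) ⟩
      false                ≡⟨ <ᵇ-irrefl t ⟨
      (t <ᵇ t)             ∎
      where open ≡-Reasoning

    edge-B⁺-A : ∀ {a i} → a < j → i ≤ t → e (j + i) a ≡ (i <ᵇ t)
    edge-B⁺-A {a} {i} a<j i≤t = trans (C¹edge-sym j k (j + i) a) (edge-A-B⁺ a<j i≤t)

    edge-B⁺-B⁺ : ∀ {i i′} → i ≤ t → i′ ≤ t → e (j + i) (j + i′) ≡ not (i ≡ᵇ i′)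
    edge-B⁺-B⁺ {i} {i′} i≤t i′≤t with m≤n⇒m<n∨m≡n i≤t | m≤n⇒m<n∨m≡n i′≤t
    ... | inj₁ i<t  | inj₁ i′<t =
      trans (C¹edge-below j (+-monoʳ-< j i<t) (+-monoʳ-< j i′<t)) (cong not (+-≡ᵇ-+ j i i′))
    ... | inj₁ i<t  | inj₂ refl =
      trans (C¹edge-sym j k (j + i) k) (trans (edge-apex-B i<t) (sym (not-≡ᵇ (<⇒≢ i<t))))
    ... | inj₂ refl | inj₁ i′<t = trans (edge-apex-B i′<t) (sym (not-≡ᵇ (>⇒≢ i′<t)))
    ... | inj₂ refl | inj₂ refl =
      trans (C¹edge-apex j k k) (trans (cong ((j ≤ᵇ k) ∧_) (<ᵇ-irrefl k))
            (trans (∧-zeroʳ _) (sym (cong not (≡ᵇ-refl t)))))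

    edge-A : ∀ {a b} → a < b → b < j → e a b ≡ true
    edge-A a<b b<j = trans (edge-A-A (<-trans a<b b<j) b<j) (not-≡ᵇ (<⇒≢ a<b))

    edge-B⁺ : ∀ {i i′} → i < i′ → i′ ≤ t → e (j + i) (j + i′) ≡ true
    edge-B⁺ i<i′ i′≤t = trans (edge-B⁺-B⁺ (<⇒≤ (<-≤-trans i<i′ i′≤t)) i′≤t) (not-≡ᵇ (<⇒≢ i<i′))

    edge-A-B : ∀ {a i} → a < j → i < t → e a (j + i) ≡ true
    edge-A-B a<j i<t = trans (edge-A-B⁺ a<j (<⇒≤ i<t)) (<ᵇ-true i<t)

    edge-A-apex : ∀ {a} → a < j → e a k ≡ false
    edge-A-apex a<j = trans (edge-A-B⁺ a<j ≤-refl) (<ᵇ-irrefl t)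

    deg-A : ∀ {a} → a < j → D a ≡ d
    deg-A {a} a<j = begin
      D a
        ≡⟨ ∑-++ j (suc t) _ ⟩
      (∑[ b < j ] [ e a b ]) + (∑[ i < suc t ] [ e a (j + i) ])
        ≡⟨ cong₂ _+_ (∑-cong j (λ b<j → cong [_] (edge-A-A a<j b<j)))
                     (∑-cong (suc t) (λ i<1+t → cong [_] (edge-A-B⁺ a<j (s≤s⁻¹ i<1+t)))) ⟩
      (∑[ b < j ] [ not (a ≡ᵇ b) ]) + (∑[ i < suc t ] [ i <ᵇ t ])
        ≡⟨ cong₂ _+_ (count-≢ a<j) (count-< t) ⟩
      d ∎
      where open ≡-Reasoning

    deg-B⁺ : ∀ {i} → i ≤ t → D (j + i) ≡ j * [ i <ᵇ t ] + t
    deg-B⁺ {i} i≤t = begin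
      D (j + i)
        ≡⟨ ∑-++ j (suc t) _ ⟩
      (∑[ b < j ] [ e (j + i) b ]) + (∑[ i′ < suc t ] [ e (j + i) (j + i′) ])
        ≡⟨ cong₂ _+_ (∑-cong j (λ b<j → cong [_] (edge-B⁺-A b<j i≤t)))
                     (∑-cong (suc t) (λ i′<1+t → cong [_] (edge-B⁺-B⁺ i≤t (s≤s⁻¹ i′<1+t)))) ⟩
      (∑[ b < j ] [ i <ᵇ t ]) + (∑[ i′ < suc t ] [ not (i ≡ᵇ i′) ])
        ≡⟨ cong₂ _+_ (∑-const j _) (count-≢ (s≤s i≤t)) ⟩
      j * [ i <ᵇ t ] + t ∎
      where open ≡-Reasoning

    deg-B : ∀ {i} → i < t → D (j + i) ≡ k
    deg-B i<t = trans (deg-B⁺ (<⇒≤ i<t))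
                      (trans (cong (λ b → j * [ b ] + t) (<ᵇ-true i<t))
                             (cong (_+ t) (*-identityʳ j)))

    deg-apex : D k ≡ t
    deg-apex = trans (deg-B⁺ ≤-refl)
                     (trans (cong (λ b → j * [ b ] + t) (<ᵇ-irrefl t)) (cong (_+ t) (*-zeroʳ j)))

    M₂-blocks : M₂ℕ (j + suc t) (C¹edge j (j + t))
                ≡ (j C 2) * (d * d) + j * (t * (d * k)) + ((t C 2) * (k * k) + t * (k * t))
    M₂-blocks = begin
      M₂ℕ N e
        ≡⟨ ∑pairs-++ j (suc t) h ⟩
      ∑pairs j h + (∑[ a < j ] ∑[ i < suc t ] h a (j + i))
      + ∑pairs (suc t) (λ i i′ → h (j + i) (j + i′))
        ≡⟨ cong₂ _+_ (cong₂ _+_ A-A A-B⁺) B⁺-B⁺ ⟩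
      (j C 2) * (d * d) + j * (t * (d * k)) + ((t C 2) * (k * k) + t * (k * t)) ∎
      where
      open ≡-Reasoning
      h : ℕ → ℕ → ℕ
      h a b = if e a b then D a * D b else 0
      edge-term : ∀ a b {x y} → e a b ≡ true → D a ≡ x → D b ≡ y → h a b ≡ x * y
      edge-term _ _ eab Da Db = trans (if-cong eab) (cong₂ _*_ Da Db)
      A-A : ∑pairs j h ≡ (j C 2) * (d * d)
      A-A = trans (∑pairs-cong {j} (λ {a} {b} a<b b<j →
                     edge-term a b (edge-A a<b b<j) (deg-A (<-trans a<b b<j)) (deg-A b<j)))
                  (∑pairs-const j _)
      A-B⁺ : (∑[ a < j ] ∑[ i < suc t ] h a (j + i)) ≡ j * (t * (d * k))
      A-B⁺ = trans (∑-cong j row) (∑-const j _)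
        where
        row : ∀ {a} → a < j → ∑[ i < suc t ] h a (j + i) ≡ t * (d * k)
        row {a} a<j = begin
          ∑[ i < suc t ] h a (j + i)
            ≡⟨ ∑-snoc t _ ⟩
          (∑[ i < t ] h a (j + i)) + h a k
            ≡⟨ cong₂ _+_ (∑-cong t (λ {i} i<t →
                            edge-term a (j + i) (edge-A-B a<j i<t) (deg-A a<j) (deg-B i<t)))
                         (if-cong (edge-A-apex a<j)) ⟩
          (∑[ i < t ] (d * k)) + 0
            ≡⟨ trans (+-identityʳ _) (∑-const t _) ⟩
          t * (d * k) ∎
      B⁺-B⁺ : ∑pairs (suc t) (λ i i′ → h (j + i) (j + i′)) ≡ (t C 2) * (k * k) + t * (k * t)
      B⁺-B⁺ = trans (∑pairs-snoc t _) (cong₂ _+_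
        (trans (∑pairs-cong {t} (λ {i} {i′} i<i′ i′<t →
                  edge-term (j + i) (j + i′) (edge-B⁺ i<i′ (<⇒≤ i′<t))
                            (deg-B (<-trans i<i′ i′<t)) (deg-B i′<t)))
               (∑pairs-const t _))
        (trans (∑-cong t (λ {i} i<t →
                  edge-term (j + i) k (edge-B⁺ i<t ≤-refl) (deg-B i<t) deg-apex))
               (∑-const t _)))

    k₃-blocks : k₃ℕ (j + suc t) (C¹edge j (j + t)) ≡ j C 3 + (j C 2) * t + j * (t C 2) + suc t C 3
    k₃-blocks = begin
      k₃ℕ N e
        ≡⟨ ∑triples-++ j (suc t) τ ⟩
      ∑triples j τ + ∑pairs j (λ u v → ∑[ w < suc t ] τ u v (j + w))
      + (∑[ u < j ] ∑pairs (suc t) (λ v w → τ u (j + v) (j + w)))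
      + ∑triples (suc t) (λ u v w → τ (j + u) (j + v) (j + w))
        ≡⟨ cong₂ _+_ (cong₂ _+_ (cong₂ _+_ A-A-A A-A-B⁺) A-B⁺-B⁺) B⁺-B⁺-B⁺ ⟩
      j C 3 + (j C 2) * t + j * (t C 2) + suc t C 3 ∎
      where
      open ≡-Reasoning
      τ : ℕ → ℕ → ℕ → ℕ
      τ u v w = [ e u v ∧ e v w ∧ e u w ]
      triangle : ∀ u v w {x y z} → e u v ≡ x → e v w ≡ y → e u w ≡ z → τ u v w ≡ [ x ∧ y ∧ z ]
      triangle _ _ _ uv vw uw = cong [_] (cong₂ _∧_ uv (cong₂ _∧_ vw uw))
      A-A-A : ∑triples j τ ≡ j C 3
      A-A-A = trans (∑triples-cong {j} (λ {u} {v} {w} u<v v<w w<j →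
                       triangle u v w (edge-A u<v (<-trans v<w w<j)) (edge-A v<w w<j)
                                      (edge-A (<-trans u<v v<w) w<j)))
                    (∑triples-one j)
      A-A-B⁺ : ∑pairs j (λ u v → ∑[ w < suc t ] τ u v (j + w)) ≡ (j C 2) * t
      A-A-B⁺ = trans (∑pairs-cong {j} row) (∑pairs-const j t)
        where
        row : ∀ {u v} → u < v → v < j → ∑[ w < suc t ] τ u v (j + w) ≡ t
        row {u} {v} u<v v<j = trans (∑-cong (suc t) (λ {w} w<1+t → let w≤t = s≤s⁻¹ w<1+t in
            trans (triangle u v (j + w) (edge-A u<v v<j) (edge-A-B⁺ v<j w≤t)
                                        (edge-A-B⁺ (<-trans u<v v<j) w≤t))
                  (cong [_] (∧-idem (w <ᵇ t)))))
          (count-< t)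
      A-B⁺-B⁺ : (∑[ u < j ] ∑pairs (suc t) (λ v w → τ u (j + v) (j + w))) ≡ j * (t C 2)
      A-B⁺-B⁺ = trans (∑-cong j row) (trans (∑-const j _) (cong (j *_) (*-identityʳ _)))
        where
        row : ∀ {u} → u < j → ∑pairs (suc t) (λ v w → τ u (j + v) (j + w)) ≡ (t C 2) * 1
        row {u} u<j = trans (∑pairs-snoc t _) (trans (cong₂ _+_
          (trans (∑pairs-cong {t} (λ {v} {w} v<w w<t →
                    triangle u (j + v) (j + w) (edge-A-B u<j (<-trans v<w w<t))
                             (edge-B⁺ v<w (<⇒≤ w<t)) (edge-A-B u<j w<t)))
                 (∑pairs-const t 1))
          (∑-zero t (λ {v} v<t →
             triangle u (j + v) k (edge-A-B u<j v<t) (edge-B⁺ v<t ≤-refl) (edge-A-apex u<j))))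
          (+-identityʳ _))
      B⁺-B⁺-B⁺ : ∑triples (suc t) (λ u v w → τ (j + u) (j + v) (j + w)) ≡ suc t C 3
      B⁺-B⁺-B⁺ = trans (∑triples-cong {suc t} (λ {u} {v} {w} u<v v<w w<1+t →
                    let w≤t = s≤s⁻¹ w<1+t in
                    triangle (j + u) (j + v) (j + w) (edge-B⁺ u<v (<⇒≤ (<-≤-trans v<w w≤t)))
                             (edge-B⁺ v<w w≤t) (edge-B⁺ (<-trans u<v v<w) w≤t)))
                 (∑triples-one (suc t))

  C¹-fits : ∀ {n m j t} → 1 ≤ n → m ≤ n C 2 → m + j ≡ (j + t + 1) C 2 →
            suc (j + t) ≤ n ⊎ (n ≡ j + t × t ≡ 0)
  C¹-fits {n} {m} {j} {t} 1≤n m≤nC2 m+j≡ = map₂ fits-below (<-≤-connex k n)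
    where
    k : ℕ
    k = j + t
    m≡ : m ≡ t + k C 2
    m≡ = +-cancelʳ-≡ j m (t + k C 2) (begin
      m + j             ≡⟨ m+j≡ ⟩
      (k + 1) C 2       ≡⟨ cong (_C 2) (+-comm k 1) ⟩
      suc k C 2         ≡⟨ [1+n]C2≡n+nC2 k ⟩
      j + t + k C 2     ≡⟨ +-assoc j t _ ⟩
      j + (t + k C 2)   ≡⟨ +-comm j _ ⟩
      t + k C 2 + j     ∎)
      where open ≡-Reasoning
    fits-below : n ≤ k → n ≡ k × t ≡ 0
    fits-below n≤k with m≤n⇒m<n∨m≡n n≤k
    ... | inj₁ n<k = contradiction (+-cancelʳ-≤ (n C 2) n 0 n+nC2≤nC2) (<⇒≱ 1≤n)
      where
      open ≤-Reasoning
      n+nC2≤nC2 : n + n C 2 ≤ n C 2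
      n+nC2≤nC2 = begin
        n + n C 2    ≡⟨ [1+n]C2≡n+nC2 n ⟨
        suc n C 2    ≤⟨ C2-mono-≤ n<k ⟩
        k C 2        ≤⟨ m≤n+m (k C 2) t ⟩
        t + k C 2    ≡⟨ m≡ ⟨
        m            ≤⟨ m≤nC2 ⟩
        n C 2        ∎
    ... | inj₂ n≡k = n≡k , n≤0⇒n≡0 (+-cancelʳ-≤ (k C 2) t 0 t+kC2≤kC2)
      where
      open ≤-Reasoning
      t+kC2≤kC2 : t + k C 2 ≤ k C 2
      t+kC2≤kC2 = begin
        t + k C 2    ≡⟨ m≡ ⟨
        m            ≤⟨ m≤nC2 ⟩
        n C 2        ≡⟨ cong (_C 2) n≡k ⟩
        k C 2        ∎

  C¹-support : ∀ {n j t} → suc (j + t) ≤ n ⊎ (n ≡ j + t × t ≡ 0) →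
               ∃[ p ] EdgesWithin p (C¹edge j (j + t)) × p ≤ n × p ≤ j + suc t
  C¹-support {j = j} {t} (inj₁ k<n) =
    suc (j + t) , C¹edge-within j (j + t) , k<n , ≤-reflexive (sym (+-suc j t))
  C¹-support {j = j} (inj₂ (refl , refl)) =
    j + 0 , subst (λ k → EdgesWithin k (C¹edge j k)) (sym (+-identityʳ j)) (C¹edge-within-j j)
          , ≤-refl , +-monoʳ-≤ j z≤n

  module _ {n p : ℕ} (j t : ℕ) (within : EdgesWithin p (C¹edge j (j + t)))
           (p≤n : p ≤ n) (p≤N : p ≤ j + suc t) where

    M₂-C¹ : M₂ (C¹ n j (j + t))
            ≡ (j C 2) * ((pred j + t) * (pred j + t)) + j * (t * ((pred j + t) * (j + t)))
              + ((t C 2) * ((j + t) * (j + t)) + t * ((j + t) * t))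
    M₂-C¹ = begin
      M₂ (C¹ n j (j + t))                  ≡⟨ M₂-restrict n (C¹edge j (j + t)) ⟩
      M₂ℕ n (C¹edge j (j + t))             ≡⟨ M₂ℕ-trim within p≤n ⟩
      M₂ℕ p (C¹edge j (j + t))             ≡⟨ M₂ℕ-trim within p≤N ⟨
      M₂ℕ (j + suc t) (C¹edge j (j + t))   ≡⟨ M₂-blocks j t ⟩
      _                                    ∎
      where open ≡-Reasoning

    k₃-C¹ : k₃ (C¹ n j (j + t)) ≡ j C 3 + (j C 2) * t + j * (t C 2) + suc t C 3
    k₃-C¹ = begin
      k₃ (C¹ n j (j + t))                  ≡⟨ k₃-restrict n (C¹edge j (j + t)) ⟩
      k₃ℕ n (C¹edge j (j + t))             ≡⟨ k₃ℕ-trim within p≤n ⟩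
      k₃ℕ p (C¹edge j (j + t))             ≡⟨ k₃ℕ-trim within p≤N ⟨
      k₃ℕ (j + suc t) (C¹edge j (j + t))   ≡⟨ k₃-blocks j t ⟩
      _                                    ∎
      where open ≡-Reasoning

open Counting
open import Data.Integer using (ℤ; +_; _+_; _-_; _*_; _^_)
open import Relation.Binary.PropositionalEquality using (_≡_)

import Data.Nat as ℕ
open import Data.Nat using (suc; pred; z≤n; s≤s)
open import Data.Nat.Combinatorics using (nCk+nC[k+1]≡[n+1]C[k+1])
open import Data.Nat.Properties using (m≤n⇒∃[o]m+o≡n)
open import Data.Integer.Properties using (pos-*; *-distribˡ-+)
open import Data.Integer.Tactic.RingSolver using (solve-∀; solve)
open import Data.List using (_∷_; [])
open import Data.Product using (_,_)
open import Relation.Binary.PropositionalEquality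
  using (refl; sym; trans; cong; cong₂; module ≡-Reasoning)

2*C2 : ∀ n → + 2 * + (n C 2) ≡ + n * (+ n - + 1)
2*C2 ℕ.zero  = refl
2*C2 (suc n) = begin
  + 2 * + (suc n C 2)            ≡⟨ cong (λ c → + 2 * + c) ([1+n]C2≡n+nC2 n) ⟩
  + 2 * (+ n + + (n C 2))        ≡⟨ *-distribˡ-+ (+ 2) (+ n) _ ⟩
  + 2 * + n + + 2 * + (n C 2)    ≡⟨ cong (λ x → + 2 * + n + x) (2*C2 n) ⟩
  + 2 * + n + + n * (+ n - + 1)  ≡⟨ step (+ n) ⟩
  + suc n * (+ suc n - + 1)      ∎
  where
  open ≡-Reasoning
  step : ∀ N → + 2 * N + N * (N - + 1) ≡ (+ 1 + N) * ((+ 1 + N) - + 1)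
  step = solve-∀

6*C3 : ∀ n → + 6 * + (n C 3) ≡ + n * (+ n - + 1) * (+ n - + 2)
6*C3 ℕ.zero  = refl
6*C3 (suc n) = begin
  + 6 * + (suc n C 3)
    ≡⟨ cong (λ c → + 6 * + c) (sym (nCk+nC[k+1]≡[n+1]C[k+1] n 2)) ⟩
  + 6 * (+ (n C 2) + + (n C 3))
    ≡⟨ *-distribˡ-+ (+ 6) (+ (n C 2)) _ ⟩
  + 6 * + (n C 2) + + 6 * + (n C 3)
    ≡⟨ cong₂ _+_ (trans (split (+ (n C 2))) (cong (+ 3 *_) (2*C2 n))) (6*C3 n) ⟩
  + 3 * (+ n * (+ n - + 1)) + + n * (+ n - + 1) * (+ n - + 2)
    ≡⟨ step (+ n) ⟩
  + suc n * (+ suc n - + 1) * (+ suc n - + 2) ∎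
  where
  open ≡-Reasoning
  split : ∀ c → + 6 * c ≡ + 3 * (+ 2 * c)
  split = solve-∀
  step : ∀ N → + 3 * (N * (N - + 1)) + N * (N - + 1) * (N - + 2)
               ≡ (+ 1 + N) * ((+ 1 + N) - + 1) * ((+ 1 + N) - + 2)
  step = solve-∀

H-C¹ : ∀ {n p} j t → EdgesWithin p (C¹edge j (j ℕ.+ t)) → p ≤ n → p ≤ j ℕ.+ suc t →
       let J = + j; T = + t; D = + pred j + T; K = J + T in
       H (C¹ n j (j ℕ.+ t))
       ≡ + (j C 2) * (D * D) + J * (T * (D * K)) + (+ (t C 2) * (K * K) + T * (K * T))
         - + 6 * (+ (j C 3) + + (j C 2) * T + J * + (t C 2) + + (suc t C 3))
H-C¹ {n} j t within p≤n p≤N = cong₂ _-_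
  (trans (cong +_ (M₂-C¹ j t within p≤n p≤N)) (cong₂ _+_
    (cong₂ _+_ (pos-*² (j C 2) d d) (trans (pos-* j _) (cong (+ j *_) (pos-*² t d k))))
    (cong₂ _+_ (pos-*² (t C 2) k k) (pos-*² t k t))))
  (trans (pos-* 6 (k₃ (C¹ n j k))) (cong (+ 6 *_) (trans (cong +_ (k₃-C¹ j t within p≤n p≤N))
    (cong₂ _+_ (cong₂ _+_ (cong (λ x → + (j C 3) + x) (pos-* (j C 2) t)) (pos-* j (t C 2))) refl))))
  where
  d k : ℕ
  d = pred j ℕ.+ t
  k = j ℕ.+ t
  pos-*² : ∀ a b c → + (a ℕ.* (b ℕ.* c)) ≡ + a * (+ b * + c)
  pos-*² a b c = trans (pos-* a _) (cong (+ a *_) (pos-* b c))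

2H-closed-form : ∀ (J₀ T X Y Z W : ℤ) → let J = + 1 + J₀; K = J + T; D = J₀ + T in
  + 2 * X ≡ J * (J - + 1) → + 2 * Y ≡ T * (T - + 1) →
  + 6 * Z ≡ J * (J - + 1) * (J - + 2) →
  + 6 * W ≡ (+ 1 + T) * ((+ 1 + T) - + 1) * ((+ 1 + T) - + 2) →
  + 2 * (X * (D * D) + J * (T * (D * K)) + (Y * (K * K) + T * (K * T))
         - + 6 * (Z + X * T + J * Y + W))
  ≡ K ^ 4 - K ^ 3 - + 6 * J * K ^ 2 + + 2 * (J ^ 2 + + 7 * J + + 1) * K - (+ 5 * J ^ 2 + + 7 * J)
2H-closed-form J₀ T X Y Z W 2X 2Y 6Z 6W =
  let J : ℤ
      J = + 1 + J₀
      K : ℤ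
      K = J + T
      D : ℤ
      D = J₀ + T
      J2 : ℤ
      J2 = J * (J - + 1)
      T2 : ℤ
      T2 = T * (T - + 1)
      poly : ℤ → ℤ → ℤ → ℤ → ℤ
      poly x y z w = x * (D * D) + + 2 * (J * (T * (D * K))) + y * (K * K) + + 2 * (T * (K * T))
                     - (+ 2 * z + + 6 * T * x + + 6 * J * y + + 2 * w)
  in begin
  _ ≡⟨ solve (J₀ ∷ T ∷ X ∷ Y ∷ Z ∷ W ∷ []) ⟩
  poly (+ 2 * X) (+ 2 * Y) (+ 6 * Z) (+ 6 * W)
    ≡⟨ cong₂ (λ x y → poly x y (+ 6 * Z) (+ 6 * W)) 2X 2Y ⟩
  poly J2 T2 (+ 6 * Z) (+ 6 * W)
    ≡⟨ cong₂ (poly J2 T2) 6Z 6W ⟩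
  poly J2 T2 (J2 * (J - + 2)) ((+ 1 + T) * ((+ 1 + T) - + 1) * ((+ 1 + T) - + 2))
    ≡⟨ solve (J₀ ∷ T ∷ []) ⟩
  -- the solver does not recognise Data.Integer's _^_, so the powers appear as _^_ unfolds them
  K * (K * (K * (K * + 1))) - K * (K * (K * + 1)) - + 6 * J * (K * (K * + 1))
  + + 2 * (J * (J * + 1) + + 7 * J + + 1) * K - (+ 5 * (J * (J * + 1)) + + 7 * J) ∎
  where open ≡-Reasoning

lemma11 : (n m j k : ℕ) → 1 ≤ n → m ≤ n C 2 → 1 ≤ j → j ≤ k
    → Data.Nat._+_ m j ≡ (Data.Nat._+_ k 1) C 2
    → (+ 2) * H (C¹ n j k)
    ≡ (+ k) ^ 4 - (+ k) ^ 3 - (+ 6) * (+ j) * (+ k) ^ 2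
    + (+ 2) * ((+ j) ^ 2 + (+ 7) * (+ j) + (+ 1)) * (+ k)
    - ((+ 5) * (+ j) ^ 2 + (+ 7) * (+ j))
lemma11 n m (suc j₀) k 1≤n m≤nC2 (s≤s z≤n) j≤k m+j≡ with m≤n⇒∃[o]m+o≡n j≤k
... | t , refl with C¹-support (C¹-fits 1≤n m≤nC2 m+j≡)
...   | p , within , p≤n , p≤N =
  trans (cong (+ 2 *_) (H-C¹ (suc j₀) t within p≤n p≤N))
        (2H-closed-form (+ j₀) (+ t) (+ (suc j₀ C 2)) (+ (t C 2)) (+ (suc j₀ C 3)) (+ (suc t C 3))
                        (2*C2 (suc j₀)) (2*C2 t) (6*C3 (suc j₀)) (6*C3 (suc t)))
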